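{- Let $\mathcal{S}$ be a string of length $n$, let $i\in[1,n]$, let $\ell=\max_{p\in\mathcal{P}_{i-1}}\mathrm{lce}(p,i)$, and let $j\in\mathcal{P}_{i-1}$ with $\mathrm{lce}(j,i)=\ell$. Assume $\ell\ge 2(i-j)$. Let $\mu=\mathcal{S}[j..i-1]$ and $r_1=j$, $r_2=j+|\mu|$, $r_3=j+2|\mu|$. If $\mathcal{S}_{r_1}\succ\mathcal{S}_{r_2}$ (a decreasing run), then $\mathrm{pss}[r_1]=\mathrm{pss}[r_2]=\mathrm{pss}[r_3]$.
   Context: $\mathcal{S}_k=\mathcal{S}[k..n]$; suffixes compared lexicographically (a proper prefix is smaller); $\mathcal{S}_0$ and $\mathcal{S}_{n+1}$ are artificial suffixes (sentinel smaller than all symbols) smaller than every $\mathcal{S}_k$, $k\in[1,n]$. $\mathrm{pss}[k]=\max\{j\in[0,k):\mathcal{S}_j\prec\mathcal{S}_k\}$. $\mathcal{P}_0=\{0\}$, $\mathcal{P}_k=\{k\}\cup\mathcal{P}_{\mathrm{pss}[k]}$. $\mathrm{lce}(a,b)$ is the length of the longest common prefix of $\mathcal{S}_a$ and $\mathcal{S}_b$. -}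

module Defs where

open import Level using (Level)
open import Data.Nat using (ℕ; zero; suc; _∸_)
open import Data.List using (List; []; _∷_; drop)
open import Data.Maybe using (Maybe; nothing; just)
open import Relation.Nullary using (Dec; yes; no; ¬_)
open import Relation.Binary.Bundles using (StrictTotalOrder)
open import Relation.Binary.Definitions using (tri<; tri≈; tri>)
import Data.List.Relation.Binary.Lex.Strict as LexS
open import Data.Empty using (⊥)
open import Data.Unit using (⊤)

-- Strings over an arbitrary (strictly totally) ordered alphabet O.
-- S is the string, n = length S, positions are 1-based.
module Str {a ℓ₁ ℓ₂ : Level} (O : StrictTotalOrder a ℓ₁ ℓ₂)
           (S : List (StrictTotalOrder.Carrier O)) where
  open StrictTotalOrder O renaming (Carrier to A)

  -- lexicographic strict order on lists; a proper prefix is smaller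
  _≺ₗ_ : List A → List A → Set _
  _≺ₗ_ = LexS.Lex-< _≈_ _<_

  _≺ₗ?_ : (xs ys : List A) → Dec (xs ≺ₗ ys)
  _≺ₗ?_ = LexS.<-decidable _≟_ _<?_

  -- suffix S_k: nothing = the artificial suffix S_0 (smaller than all);
  -- for k ≥ 1, S_k = S[k..n] (so S_{n+1} is the empty suffix, the
  -- artificial sentinel suffix smaller than every S_k, k ∈ [1,n]).
  suf : ℕ → Maybe (List A)
  suf zero    = nothing
  suf (suc k) = just (drop k S)

  _≺ᴹ_ : Maybe (List A) → Maybe (List A) → Set _
  nothing ≺ᴹ nothing = Data.Empty.Polymorphic.⊥
    where import Data.Empty.Polymorphic
  nothing ≺ᴹ just _  = Data.Unit.Polymorphic.⊤
    where import Data.Unit.Polymorphic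
  just _  ≺ᴹ nothing = Data.Empty.Polymorphic.⊥
    where import Data.Empty.Polymorphic
  just x  ≺ᴹ just y  = x ≺ₗ y

  _≺ᴹ?_ : (x y : Maybe (List A)) → Dec (x ≺ᴹ y)
  nothing ≺ᴹ? nothing = no (λ ())
  nothing ≺ᴹ? just _  = yes _
  just _  ≺ᴹ? nothing = no (λ ())
  just x  ≺ᴹ? just y  = x ≺ₗ? y

  _≺_ : ℕ → ℕ → Set _
  a ≺ b = suf a ≺ᴹ suf b

  pssSearch : ℕ → ℕ → ℕ
  pssSearch k zero    = zero
  pssSearch k (suc m) with suf m ≺ᴹ? suf k
  ... | yes _ = m
  ... | no  _ = pssSearch k m

  -- pss[k] = max { j ∈ [0,k) : S_j ≺ S_k }   (meaningful for k ≥ 1)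
  pss : ℕ → ℕ
  pss k = pssSearch k k

  -- membership in P_k :  P_0 = {0},  P_k = {k} ∪ P_{pss[k]} for k ≥ 1
  data _∈P_ : ℕ → ℕ → Set where
    here  : ∀ {k} → k ∈P k
    there : ∀ {p k} → p ∈P pss (suc k) → p ∈P suc k

  lcp : List A → List A → ℕ
  lcp (x ∷ xs) (y ∷ ys) with compare x y
  ... | tri≈ _ _ _ = suc (lcp xs ys)
  ... | tri< _ _ _ = zero
  ... | tri> _ _ _ = zero
  lcp _ _ = zero

  -- lce(a,b); the artificial suffix S_0 shares no prefix with anything
  lceᴹ : Maybe (List A) → Maybe (List A) → ℕ
  lceᴹ (just x) (just y) = lcp x y
  lceᴹ _ _ = zero

  lce : ℕ → ℕ → ℕ
  lce a b = lceᴹ (suf a) (suf b)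

-- Write d = i − j.  A member p of P_k is smaller than every S_q with p < q ≤ k,
-- so S_j is minimal among the S_q, q ∈ (j, i].  Key step: if S_j is minimal on
-- (j, j + d), agrees with S_{j+d} on d symbols, and S_{j+d} ≺ S_j, then
-- pss[j+d] = pss[j].  Indeed no q ∈ (pss[j], j + d) has S_q ≺ S_j, hence none
-- has S_q ≺ S_{j+d}; and S_{pss[j]} ≺ S_{j+d}, for otherwise S_{pss[j]} agrees
-- with S_j on d symbols and then S_{pss[j]+d} ≺ S_{j+d} ≺ S_j.  Since
-- lce(j, i) ≥ 2d, the hypotheses of the key step hold again one period later,
-- giving pss[j+d] = pss[j+2d].
module Submission where

open import Defs
open import Level using (Level; lift)
open import Function using (_∘_; id)
open import Data.Nat using (ℕ; zero; suc; _+_; _*_; _∸_; _≤_; _<_; _≤?_; z≤n; s≤s; z<s)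
open import Data.Nat.Properties
open import Data.List using (List; []; _∷_; length; drop; take)
open import Data.List.Properties using (length-drop; drop-drop)
open import Data.Product using (_×_; _,_; proj₂)
open import Data.Sum using (_⊎_; inj₁; inj₂; [_,_]′)
open import Relation.Nullary using (¬_; yes; no)
open import Data.Empty using (⊥-elim)
open import Relation.Binary.Bundles using (StrictTotalOrder)
open import Relation.Binary.Definitions using (tri<; tri≈; tri>)
open import Relation.Binary.PropositionalEquality using (_≡_; _≢_; refl; sym; trans; cong; subst; subst₂)
import Data.List.Relation.Binary.Lex.Strict as LexS
open import Data.List.Relation.Binary.Lex.Strict using (base; halt; this; next)
open import Data.List.Relation.Binary.Pointwise using (Pointwise; []; _∷_; Pointwise-length)
import Data.List.Relation.Binary.Pointwise.Properties as Pointwise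
open import Algebra.Properties.CommutativeSemigroup +-commutativeSemigroup using (xy∙z≈xz∙y)

module Suffixes {a ℓ₁ ℓ₂ : Level} (O : StrictTotalOrder a ℓ₁ ℓ₂)
                (S : List (StrictTotalOrder.Carrier O)) where
  open StrictTotalOrder O
    using (_≈_; compare; irrefl; <-respʳ-≈; <-respˡ-≈; module Eq) renaming (Carrier to A)
  open Str O S
  module Lex = StrictTotalOrder (LexS.<-strictTotalOrder O)

  n : ℕ
  n = length S

  _≈[_]_ : List A → ℕ → List A → Set _
  xs ≈[ d ] ys = Pointwise _≈_ (take d xs) (take d ys)

  ≈[]-refl : ∀ {d xs} → xs ≈[ d ] xs
  ≈[]-refl = Pointwise.refl Eq.refl

  ≈[]-sym : ∀ {d xs ys} → xs ≈[ d ] ys → ys ≈[ d ] xs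
  ≈[]-sym = Pointwise.symmetric Eq.sym

  lcp-suc : ∀ {k x y xs ys} → suc k ≤ lcp (x ∷ xs) (y ∷ ys) → x ≈ y × k ≤ lcp xs ys
  lcp-suc {x = x} {y} h with compare x y
  ... | tri≈ _ x≈y _ = x≈y , ≤-pred h

  ≤lcp⇒≈[] : ∀ d xs ys → d ≤ lcp xs ys → xs ≈[ d ] ys
  ≤lcp⇒≈[] zero    _        _        _ = []
  ≤lcp⇒≈[] (suc d) (x ∷ xs) (y ∷ ys) h = let x≈y , h′ = lcp-suc h in x≈y ∷ ≤lcp⇒≈[] d xs ys h′
  ≤lcp⇒≈[] (suc d) []       _        ()
  ≤lcp⇒≈[] (suc d) (x ∷ xs) []       ()

  ≤lcp⇒drop-≈[] : ∀ t {d} xs ys → t + d ≤ lcp xs ys → drop t xs ≈[ d ] drop t ys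
  ≤lcp⇒drop-≈[] zero    xs       ys       h = ≤lcp⇒≈[] _ xs ys h
  ≤lcp⇒drop-≈[] (suc t) (x ∷ xs) (y ∷ ys) h = ≤lcp⇒drop-≈[] t xs ys (proj₂ (lcp-suc h))
  ≤lcp⇒drop-≈[] (suc t) []       _        ()
  ≤lcp⇒drop-≈[] (suc t) (x ∷ xs) []       ()

  ≺ₗ-drop : ∀ d {xs ys} → xs ≈[ d ] ys → xs ≺ₗ ys → drop d xs ≺ₗ drop d ys
  ≺ₗ-drop zero    _                          xs≺ys          = xs≺ys
  ≺ₗ-drop (suc d) {[]}     {[]}     _          (base ())
  ≺ₗ-drop (suc d) {[]}     {_ ∷ _}  ()         _
  ≺ₗ-drop (suc d) {_ ∷ _}  {[]}     ()         _
  ≺ₗ-drop (suc d) {_ ∷ _}  {_ ∷ _}  (x≈y ∷ _)  (this x<y)     = ⊥-elim (irrefl x≈y x<y)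
  ≺ₗ-drop (suc d) {_ ∷ _}  {_ ∷ _}  (_ ∷ p)    (next _ xs≺ys) = ≺ₗ-drop d p xs≺ys

  ≺ₗ-transfer : ∀ d {xs xs′ ys ys′} → xs ≈[ d ] xs′ → ys ≈[ d ] ys′ → xs ≺ₗ ys →
                xs ≈[ d ] ys ⊎ xs′ ≺ₗ ys′
  ≺ₗ-transfer zero _ _ _ = inj₁ []
  ≺ₗ-transfer (suc d) {[]}    {[]}    {[]}    {_}     _  _  (base ())
  ≺ₗ-transfer (suc d) {[]}    {[]}    {_ ∷ _} {_ ∷ _} _  _  halt = inj₂ halt
  ≺ₗ-transfer (suc d) {[]}    {_ ∷ _} {_}     {_}     () _  _
  ≺ₗ-transfer (suc d) {_ ∷ _} {[]}    {_}     {_}     () _  _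
  ≺ₗ-transfer (suc d) {_}     {_}     {_ ∷ _} {[]}    _  () _
  ≺ₗ-transfer (suc d) {_}     {_}     {[]}    {_ ∷ _} _  () _
  ≺ₗ-transfer (suc d) {_ ∷ _} {_ ∷ _} {_ ∷ _} {_ ∷ _} (x≈x′ ∷ _) (y≈y′ ∷ _) (this x<y) =
    inj₂ (this (<-respʳ-≈ y≈y′ (<-respˡ-≈ x≈x′ x<y)))
  ≺ₗ-transfer (suc d) {_ ∷ _} {_ ∷ _} {_ ∷ _} {_ ∷ _} (x≈x′ ∷ p) (y≈y′ ∷ q) (next x≈y xs≺ys)
    with ≺ₗ-transfer d p q xs≺ys
  ... | inj₁ xs≈ys   = inj₁ (x≈y ∷ xs≈ys)
  ... | inj₂ xs′≺ys′ = inj₂ (next (Eq.trans (Eq.sym x≈x′) (Eq.trans x≈y y≈y′)) xs′≺ys′)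

  ≺-trans : ∀ {x y z} → x ≺ y → y ≺ z → x ≺ z
  ≺-trans {zero}  {suc _} {suc _} _   _   = _
  ≺-trans {suc _} {suc _} {suc _} x≺y y≺z = Lex.trans x≺y y≺z

  ≺-asym : ∀ {x y} → x ≺ y → ¬ (y ≺ x)
  ≺-asym {zero}  {zero}  (lift ())
  ≺-asym {suc _} {zero}  (lift ())
  ≺-asym {zero}  {suc _} _ (lift ())
  ≺-asym {suc _} {suc _} = Lex.asym

  ≺-irrefl : ∀ {x} → ¬ (x ≺ x)
  ≺-irrefl x≺x = ≺-asym x≺x x≺x

  ≺-connex : ∀ {x y} → x ≢ y → x ≤ n → y ≤ n → x ≺ y ⊎ y ≺ x
  ≺-connex {zero}  {zero}  x≢y _ _ = ⊥-elim (x≢y refl)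
  ≺-connex {zero}  {suc _} _   _ _ = inj₁ _
  ≺-connex {suc _} {zero}  _   _ _ = inj₂ _
  ≺-connex {suc x} {suc y} x≢y x≤n y≤n with Lex.compare (drop x S) (drop y S)
  ... | tri< x≺y _ _ = inj₁ x≺y
  ... | tri> _ _ y≺x = inj₂ y≺x
  ... | tri≈ _ x≈y _ = ⊥-elim (x≢y (cong suc (∸-cancelˡ-≡ (<⇒≤ x≤n) (<⇒≤ y≤n) equal-lengths)))
    where
      equal-lengths : n ∸ x ≡ n ∸ y
      equal-lengths = trans (sym (length-drop x S)) (trans (Pointwise-length x≈y) (length-drop y S))

  ≺-shift : ∀ {x y} d → drop x S ≈[ d ] drop y S → suc x ≺ suc y → (suc x + d) ≺ (suc y + d)
  ≺-shift {x} {y} d x≈y x≺y = subst₂ _≺ₗ_ (drop-drop x d S) (drop-drop y d S) (≺ₗ-drop d x≈y x≺y)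

  pssSearch≤ : ∀ k m → pssSearch k m ≤ m
  pssSearch≤ k zero = z≤n
  pssSearch≤ k (suc m) with suf m ≺ᴹ? suf k
  ... | yes _ = n≤1+n m
  ... | no  _ = m≤n⇒m≤1+n (pssSearch≤ k m)

  pssSearch< : ∀ k {m} → 0 < m → pssSearch k m < m
  pssSearch< k {suc m} _ with suf m ≺ᴹ? suf k
  ... | yes _ = ≤-refl
  ... | no  _ = s≤s (pssSearch≤ k m)

  pssSearch≺ : ∀ {k} m → 0 < k → pssSearch k m ≺ k
  pssSearch≺ {suc _} zero    _   = _
  pssSearch≺ {k}     (suc m) 0<k with suf m ≺ᴹ? suf k
  ... | yes m≺k = m≺k
  ... | no  _   = pssSearch≺ m 0<k

  pssSearch-maximal : ∀ {k m q} → pssSearch k m < q → q < m → ¬ (q ≺ k)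
  pssSearch-maximal {k} {suc m} {q} s<q q<1+m with suf m ≺ᴹ? suf k
  ... | yes _ = ⊥-elim (<⇒≱ s<q (≤-pred q<1+m))
  ... | no m⊀k with m≤n⇒m<n∨m≡n (≤-pred q<1+m)
  ...   | inj₁ q<m  = pssSearch-maximal s<q q<m
  ...   | inj₂ refl = m⊀k

  pss-unique : ∀ {k p} → p < k → p ≺ k → (∀ q → p < q → q < k → ¬ (q ≺ k)) → pss k ≡ p
  pss-unique {k} {p} p<k p≺k none with <-cmp (pss k) p
  ... | tri< s<p _ _ = ⊥-elim (pssSearch-maximal s<p p<k p≺k)
  ... | tri≈ _ s≡p _ = s≡p
  ... | tri> _ _ p<s = ⊥-elim (none (pss k) p<s (pssSearch< k 0<k) (pssSearch≺ k 0<k))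
    where
      0<k : 0 < k
      0<k = ≤-<-trans z≤n p<k

  MinBetween : ℕ → ℕ → Set _
  MinBetween x y = ∀ q → x < q → q < y → x ≺ q

  MinBetween-join : ∀ {p r m} → p ≤ r → MinBetween p (suc r) → MinBetween r m → MinBetween p m
  MinBetween-join {p} {r} p≤r p-min r-min q p<q q<m with q ≤? r | m≤n⇒m<n∨m≡n p≤r
  ... | yes q≤r | _         = p-min q p<q (s≤s q≤r)
  ... | no  q≰r | inj₂ refl = r-min q (≰⇒> q≰r) q<m
  ... | no  q≰r | inj₁ p<r  = ≺-trans (p-min r p<r ≤-refl) (r-min q (≰⇒> q≰r) q<m)

  pss-minimal : ∀ {k} → 0 < k → k ≤ n → MinBetween (pss k) (suc k)
  pss-minimal {k} 0<k k≤n q s<q q≤k with m≤n⇒m<n∨m≡n (≤-pred q≤k)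
  ... | inj₂ refl = pssSearch≺ k 0<k
  ... | inj₁ q<k with ≺-connex (<⇒≢ q<k) (≤-trans (<⇒≤ q<k) k≤n) k≤n
  ...   | inj₁ q≺k = ⊥-elim (pssSearch-maximal s<q q<k q≺k)
  ...   | inj₂ k≺q = ≺-trans (pssSearch≺ k 0<k) k≺q

  ∈P⇒≤ : ∀ {p k} → p ∈P k → p ≤ k
  ∈P⇒≤ here = ≤-refl
  ∈P⇒≤ {k = suc k} (there p∈P) = ≤-trans (∈P⇒≤ p∈P) (<⇒≤ (pssSearch< (suc k) z<s))

  ∈P⇒MinBetween : ∀ {p k} → p ∈P k → k ≤ n → MinBetween p (suc k)
  ∈P⇒MinBetween here _ q p<q q≤p = ⊥-elim (<⇒≱ p<q (≤-pred q≤p))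
  ∈P⇒MinBetween {k = suc k} (there p∈P) k≤n =
    MinBetween-join (∈P⇒≤ p∈P)
      (∈P⇒MinBetween p∈P (≤-trans (<⇒≤ (pssSearch< (suc k) z<s)) k≤n))
      (pss-minimal z<s k≤n)

  pss-repeat : ∀ j d → 0 < d → drop j S ≈[ d ] drop (j + d) S →
               MinBetween (suc j) (suc j + d) → (suc j + d) ≺ suc j →
               pss (suc j + d) ≡ pss (suc j)
  pss-repeat j d 0<d J≈I J-min I≺J =
    pss-unique s<I (≺I (pss J) s<J (pssSearch≺ J z<s) none≺J) none≺I
    where
      J I : ℕ
      J = suc j
      I = suc j + d

      s<J : pss J < J
      s<J = pssSearch< J z<s

      s<I : pss J < I
      s<I = <-≤-trans s<J (m≤m+n J d)

      none≺J : ∀ q → pss J < q → q < I → ¬ (q ≺ J)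
      none≺J q s<q q<I q≺J with <-cmp q J
      ... | tri< q<J _ _ = pssSearch-maximal s<q q<J q≺J
      ... | tri≈ _ refl _ = ≺-irrefl {q} q≺J
      ... | tri> _ _ J<q = ≺-asym {J} (J-min q J<q q<I) q≺J

      none≺I : ∀ q → pss J < q → q < I → ¬ (q ≺ I)
      none≺I q s<q q<I q≺I = none≺J q s<q q<I (≺-trans {q} {I} {J} q≺I I≺J)

      ≺I : ∀ p → p < J → p ≺ J → (∀ q → p < q → q < I → ¬ (q ≺ J)) → p ≺ I
      ≺I zero    _   _   _    = _
      ≺I (suc p) p<J p≺J none with ≺ₗ-transfer d ≈[]-refl J≈I p≺J
      ... | inj₂ p≺I = p≺I
      ... | inj₁ p≈J = ⊥-elim (none (suc p + d) (m<m+n (suc p) 0<d) (+-monoˡ-< d p<J)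
                                 (≺-trans {suc p + d} {I} {J} (≺-shift {p} {j} d p≈J p≺J) I≺J))

  MinBetween-offsets : ∀ {x d} → (∀ t → 0 < t → t < d → x ≺ (x + t)) → MinBetween x (x + d)
  MinBetween-offsets {x} {d} x≺x+t q x<q q<x+d =
    subst (x ≺_) x+t≡q (x≺x+t t (m<n⇒0<n∸m x<q) (+-cancelˡ-< x t d (subst (_< x + d) (sym x+t≡q) q<x+d)))
    where
      t : ℕ
      t = q ∸ x
      x+t≡q : x + t ≡ q
      x+t≡q = m+[n∸m]≡n (<⇒≤ x<q)

  MinBetween-propagates : ∀ j d → d + d ≤ lcp (drop j S) (drop (j + d) S) →
                          MinBetween (suc j) (suc j + d) → MinBetween (suc j + d) (suc j + d + d)
  MinBetween-propagates j d d+d≤lcp J-min = MinBetween-offsets I≺I+t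
    where
      J≈I : drop j S ≈[ d ] drop (j + d) S
      J≈I = ≤lcp⇒drop-≈[] 0 _ _ (≤-trans (m≤m+n d d) d+d≤lcp)

      I≺I+t : ∀ t → 0 < t → t < d → (suc j + d) ≺ (suc j + d + t)
      I≺I+t t 0<t t<d = [ shifted , id ]′ (≺ₗ-transfer d J≈I r≈q J≺r)
        where
          J≺r : suc j ≺ (suc j + t)
          J≺r = J-min (suc j + t) (m<m+n (suc j) 0<t) (+-monoʳ-< (suc j) t<d)

          r≈q : drop (j + t) S ≈[ d ] drop (j + d + t) S
          r≈q = subst₂ (λ u v → u ≈[ d ] v) (drop-drop j t S) (drop-drop (j + d) t S)
                  (≤lcp⇒drop-≈[] t _ _ (≤-trans (+-monoˡ-≤ d (<⇒≤ t<d)) d+d≤lcp))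

          shifted : drop j S ≈[ d ] drop (j + t) S → (suc j + d) ≺ (suc j + d + t)
          shifted J≈r = subst (λ k → (suc j + d) ≺ suc k) (xy∙z≈xz∙y j t d)
                          (≺-shift {j} {j + t} d J≈r J≺r)

  pss-decreasing-run : ∀ j d → 0 < d → MinBetween (suc j) (suc j + d) →
                       2 * d ≤ lcp (drop j S) (drop (j + d) S) → (suc j + d) ≺ suc j →
                       pss (suc j) ≡ pss (suc j + d) × pss (suc j + d) ≡ pss (suc j + 2 * d)
  pss-decreasing-run j d 0<d J-min 2d≤lcp I≺J =
      sym (pss-repeat j d 0<d J≈I J-min I≺J)
    , sym (trans (cong (pss ∘ suc) j+2d≡j+d+d) (pss-repeat (j + d) d 0<d I≈K I-min K≺I))
    where
      j+2d≡j+d+d : j + 2 * d ≡ j + d + d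
      j+2d≡j+d+d = trans (cong (λ e → j + (d + e)) (+-identityʳ d)) (sym (+-assoc j d d))

      d+d≤lcp : d + d ≤ lcp (drop j S) (drop (j + d) S)
      d+d≤lcp = subst (_≤ lcp (drop j S) (drop (j + d) S)) (cong (d +_) (+-identityʳ d)) 2d≤lcp

      J≈I : drop j S ≈[ d ] drop (j + d) S
      J≈I = ≤lcp⇒drop-≈[] 0 _ _ (≤-trans (m≤m+n d d) d+d≤lcp)

      I≈K : drop (j + d) S ≈[ d ] drop (j + d + d) S
      I≈K = subst₂ (λ u v → u ≈[ d ] v) (drop-drop j d S) (drop-drop (j + d) d S)
              (≤lcp⇒drop-≈[] d _ _ d+d≤lcp)

      I-min : MinBetween (suc j + d) (suc j + d + d)
      I-min = MinBetween-propagates j d d+d≤lcp J-min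

      K≺I : (suc j + d + d) ≺ (suc j + d)
      K≺I = ≺-shift {j + d} {j} d (≈[]-sym J≈I) I≺J

mainTheorem9 : ∀ {a ℓ₁ ℓ₂ : Level} (O : StrictTotalOrder a ℓ₁ ℓ₂)
    (S : List (StrictTotalOrder.Carrier O)) (i j : ℕ) →
    1 ≤ i → i ≤ length S →
    Str._∈P_ O S j (i ∸ 1) →
    (∀ p → Str._∈P_ O S p (i ∸ 1) → Str.lce O S p i ≤ Str.lce O S j i) →
    2 * (i ∸ j) ≤ Str.lce O S j i →
    Str._≺_ O S (j + (i ∸ j)) j →
    (Str.pss O S j ≡ Str.pss O S (j + (i ∸ j)))
    × (Str.pss O S (j + (i ∸ j)) ≡ Str.pss O S (j + 2 * (i ∸ j)))
mainTheorem9 O S (suc i) zero    _ _   _   _ ()     _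
mainTheorem9 O S (suc i) (suc j) _ i<n j∈P _ 2d≤lce I≺J =
  pss-decreasing-run j d (m<n⇒0<n∸m j<i) (subst (MinBetween (suc j) ∘ suc) i≡j+d J-min)
    (subst (λ k → 2 * d ≤ lcp (drop j S) (drop k S)) i≡j+d 2d≤lce) I≺J
  where
    open Str O S using (lcp)
    open Suffixes O S

    j<i : j < i
    j<i = ∈P⇒≤ j∈P

    d : ℕ
    d = i ∸ j

    i≡j+d : i ≡ j + d
    i≡j+d = sym (m+[n∸m]≡n (<⇒≤ j<i))

    J-min : MinBetween (suc j) (suc i)
    J-min = ∈P⇒MinBetween j∈P (<⇒≤ i<n)
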